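{- Let $G$ be a $(\delta-2)$-fault Hamiltonian graph with minimum degree $\delta\geq 3$. If $|G|$ is even, then $fmp(G)=\delta$.
   Context: All graphs are finite, simple, undirected; $|G|$ is the number of vertices. For a set $X$ of vertices and/or edges, $G-X$ is obtained by deleting the vertices of $X$ (with incident edges) and the edges of $X$. $G$ is $f$-fault Hamiltonian if $G-X$ has a Hamiltonian cycle for every set $X$ of vertices and/or edges with $|X|\leq f$. A fractional perfect matching is $g:E(G)\to[0,1]$ with $\sum_{e\ni v}g(e)=1$ for all $v$. $fmp(G)$ is the minimum size of $F\subseteq E(G)$ such that $G-F$ has no fractional perfect matching.
   Formalization: Fractional perfect matchings take values in the rationals between 0 and 1 instead of the real interval $[0,1]$. -}

module Defs where

open import Data.Nat using (ℕ; zero; suc; _+_; _≤_; _<_)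
open import Data.Bool using (Bool; true; false; T; if_then_else_)
open import Data.Fin using (Fin; zero; suc; toℕ)
open import Data.List using (List; []; _∷_; _++_; [_]; length)
open import Data.List.Membership.Propositional using (_∈_)
open import Data.List.Relation.Unary.All using (All)
open import Data.List.Relation.Unary.Linked using (Linked)
open import Data.List.Relation.Unary.Unique.Propositional using (Unique)
open import Data.Product using (Σ; ∃; _×_; _,_)
open import Data.Rational as ℚ using (ℚ; 0ℚ; 1ℚ)
open import Relation.Binary.PropositionalEquality using (_≡_)
open import Relation.Nullary using (¬_)

record Graph (n : ℕ) : Set where
  field
    adj    : Fin n → Fin n → Bool
    sym    : ∀ u v → adj u v ≡ adj v u
    irrefl : ∀ v → adj v v ≡ false

open Graph public

Edge : ∀ {n} → Graph n → Fin n → Fin n → Set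
Edge G u v = T (adj G u v)

count : ∀ {n} → (Fin n → Bool) → ℕ
count {zero}  p = 0
count {suc n} p = (if p zero then 1 else 0) + count (λ i → p (suc i))

degree : ∀ {n} → Graph n → Fin n → ℕ
degree G v = count (adj G v)

MinDegree : ∀ {n} → Graph n → ℕ → Set
MinDegree G δ = (∀ v → δ ≤ degree G v) × (∃ λ v → degree G v ≡ δ)

EdgeList : ∀ {n} → Graph n → List (Fin n × Fin n) → Set
EdgeList G F = All (λ { (u , v) → (toℕ u < toℕ v) × Edge G u v }) F

EdgeMinus : ∀ {n} → Graph n → List (Fin n × Fin n) → Fin n → Fin n → Set
EdgeMinus G F u v = Edge G u v × ¬ ((u , v) ∈ F) × ¬ ((v , u) ∈ F)

-- G - X for X = (XV vertices, XE edges), |X| = length XV + length XE.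
HamCycleMinus : ∀ {n} → Graph n → List (Fin n) → List (Fin n × Fin n) → Set
HamCycleMinus {n} G XV XE =
  Σ (Fin n) λ x → Σ (List (Fin n)) λ xs →
      Unique (x ∷ xs)
    × All (λ w → ¬ (w ∈ XV)) (x ∷ xs)
    × (∀ w → ¬ (w ∈ XV) → w ∈ (x ∷ xs))
    × 3 ≤ length (x ∷ xs)
    × Linked (EdgeMinus G XE) (x ∷ xs ++ [ x ])

FaultHamiltonian : ∀ {n} → Graph n → ℕ → Set
FaultHamiltonian {n} G f =
  (XV : List (Fin n)) (XE : List (Fin n × Fin n)) →
  EdgeList G XE → length XV + length XE ≤ f → HamCycleMinus G XV XE

sumℚ : ∀ {n} → (Fin n → ℚ) → ℚ
sumℚ {zero}  g = 0ℚ
sumℚ {suc n} g = g zero ℚ.+ sumℚ (λ i → g (suc i))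

-- fractional perfect matching of the graph with adjacency relation E
-- (E symmetric irreflexive); g u v = g v u is the weight of edge uv.
IsFracPerfectMatching : ∀ {n} → (Fin n → Fin n → Set) → (Fin n → Fin n → ℚ) → Set
IsFracPerfectMatching {n} E g =
    (∀ u v → g u v ≡ g v u)
  × (∀ u v → 0ℚ ℚ.≤ g u v × g u v ℚ.≤ 1ℚ)
  × (∀ u v → ¬ E u v → g u v ≡ 0ℚ)
  × (∀ v → sumℚ (g v) ≡ 1ℚ)

HasFPM : ∀ {n} → (Fin n → Fin n → Set) → Set
HasFPM {n} E = Σ (Fin n → Fin n → ℚ) (IsFracPerfectMatching E)

-- fmp(G) = k : the minimum size of an edge set F ⊆ E(G) with G - F having
-- no fractional perfect matching equals k.
FmpEq : ∀ {n} → Graph n → ℕ → Set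
FmpEq {n} G k =
    (Σ (List (Fin n × Fin n)) λ F →
        EdgeList G F × Unique F × length F ≡ k × ¬ HasFPM (EdgeMinus G F))
  × ((F : List (Fin n × Fin n)) → EdgeList G F → length F < k →
        HasFPM (EdgeMinus G F))

-- Deleting the δ edges at a vertex of minimum degree isolates it, so fmp(G) ≤ δ.
-- Conversely let |F| < δ. If F = ∅, a Hamiltonian cycle of G has even length
-- and alternate edges of it form a perfect matching. Otherwise remove one edge
-- ab from F: at most δ - 2 edges remain, so G - (F - ab) has a Hamiltonian
-- cycle C. If ab is not an edge of C, the alternate edges of C avoid ab; if it
-- is, run around C starting at b and ending at a, and pair the vertices
-- consecutively along this Hamiltonian path: a and b are then in different
-- pairs. Either way G - F has a perfect matching, and weight 1 on its edges is
-- a fractional perfect matching.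
module Submission where

open import Defs
open import Data.Nat as ℕ using (ℕ; zero; suc; _≤_; _<_; _∸_; z≤n; s≤s; s≤s⁻¹)
open import Data.Nat.Divisibility using (_∣_; divides)
open import Data.Nat.Properties using (≤-trans; m≤n+m∸n; ≤∧≢⇒<; ≮⇒≥)
open import Data.Bool using (Bool; true; false; T; if_then_else_)
open import Data.Fin using (Fin; zero; suc; toℕ; _≟_)
open import Data.Fin.Properties using (toℕ-injective)
open import Data.List using (List; []; _∷_; _++_; [_]; length; map; filterᵇ; allFin; tabulate)
open import Data.List.Properties using (++-assoc; length-map; length-tabulate)
open import Data.List.Membership.Propositional using (_∈_)
open import Data.List.Membership.Propositional.Properties using (∈-allFin; ∈-filter⁺; ∈-filter⁻; ∈-map⁺; ∈-++⁺ʳ)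
open import Data.List.Membership.Propositional.Properties.WithK using (unique∧set⇒bag)
open import Data.List.Relation.Unary.Any using (here; there)
open import Data.List.Relation.Unary.All as All using (All; []; _∷_)
open import Data.List.Relation.Unary.All.Properties as All using ()
open import Data.List.Relation.Unary.AllPairs using (_∷_)
open import Data.List.Relation.Unary.Linked as Linked using (Linked; []; [-]; _∷_)
open import Data.List.Relation.Unary.Unique.Propositional using (Unique)
import Data.List.Relation.Unary.Unique.Propositional.Properties as Unique
open import Data.List.Relation.Binary.BagAndSetEquality using (∼bag⇒↭)
open import Data.List.Relation.Binary.Permutation.Propositional using (_↭_; ↭-sym; ↭-trans; ↭-reflexive; ↭⇒↭ₛ)
open import Data.List.Relation.Binary.Permutation.Propositional.Properties using (++-comm; ∈-resp-↭; ↭-length)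
import Data.List.Relation.Binary.Permutation.Setoid.Properties as PermutationSetoid
open import Data.Product using (Σ; ∃; _×_; _,_; proj₁; proj₂; swap)
open import Data.Product.Properties using (≡-dec)
open import Data.Sum using (_⊎_; inj₁; inj₂)
open import Data.Empty using (⊥-elim)
open import Data.Rational as ℚ using (ℚ; 0ℚ; 1ℚ)
import Data.Rational.Properties as ℚ
open import Function using (_∘_; mk⇔)
open import Relation.Binary.PropositionalEquality using (_≡_; _≢_; refl; trans; cong; subst; setoid) renaming (sym to ≡-sym)
open import Relation.Nullary using (¬_; Dec; yes; no; does)
open import Relation.Nullary.Decidable using (_⊎-dec_; T?)

sumℚ-zero : ∀ {n} (f : Fin n → ℚ) → (∀ i → f i ≡ 0ℚ) → sumℚ f ≡ 0ℚ
sumℚ-zero {zero}  f f≡0 = refl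
sumℚ-zero {suc n} f f≡0 rewrite f≡0 zero | sumℚ-zero (f ∘ suc) (f≡0 ∘ suc) = refl

indicator : ∀ {n} → Fin n → Fin n → ℚ
indicator w i = if does (w ≟ i) then 1ℚ else 0ℚ

sumℚ-indicator : ∀ {n} (w : Fin n) → sumℚ (indicator w) ≡ 1ℚ
sumℚ-indicator {suc n} zero =
  trans (cong (1ℚ ℚ.+_) (sumℚ-zero {n} (indicator zero ∘ suc) (λ _ → refl))) (ℚ.+-identityʳ 1ℚ)
sumℚ-indicator (suc w)     = trans (ℚ.+-identityˡ _) (sumℚ-indicator w)

indicator-bounds : ∀ {n} (w i : Fin n) → 0ℚ ℚ.≤ indicator w i × indicator w i ℚ.≤ 1ℚ
indicator-bounds w i with w ≟ i
... | yes _ = ℚ.nonNegative⁻¹ 1ℚ , ℚ.≤-refl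
... | no _  = ℚ.≤-refl , ℚ.nonNegative⁻¹ 1ℚ

isolated⇒¬HasFPM : ∀ {n} {E : Fin n → Fin n → Set} {v} → (∀ u → ¬ E v u) → ¬ HasFPM E
isolated⇒¬HasFPM {v = v} isolated (g , _ , _ , g-off-E , g-sum) with () ←
  trans (≡-sym (sumℚ-zero (g v) (λ u → g-off-E v u (isolated u)))) (g-sum v)

module _ {A : Set} where

  ++⁻ˡ : ∀ {R : A → A → Set} xs {ys} → Linked R (xs ++ ys) → Linked R xs
  ++⁻ˡ []           l       = []
  ++⁻ˡ (x ∷ [])     l       = [-]
  ++⁻ˡ (x ∷ y ∷ xs) (r ∷ l) = r ∷ ++⁻ˡ (y ∷ xs) l

  ++⁻ʳ : ∀ {R : A → A → Set} xs {ys} → Linked R (xs ++ ys) → Linked R ys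
  ++⁻ʳ []       l = l
  ++⁻ʳ (x ∷ xs) l = ++⁻ʳ xs (Linked.tail l)

  ++-join : ∀ {R : A → A → Set} xs {y zs} →
    Linked R (xs ++ [ y ]) → Linked R (y ∷ zs) → Linked R (xs ++ y ∷ zs)
  ++-join []            _         l = l
  ++-join (x ∷ [])      (r ∷ [-]) l = r ∷ l
  ++-join (x ∷ x′ ∷ xs) (r ∷ l′)  l = r ∷ ++-join (x′ ∷ xs) l′ l

  linkedOrSplit : {P : A → A → Set} → (∀ u v → Dec (P u v)) → ∀ c →
    (∃ λ s → ∃ λ u → ∃ λ v → ∃ λ t → c ≡ s ++ u ∷ v ∷ t × P u v) ⊎ Linked (λ u v → ¬ P u v) c
  linkedOrSplit P? []          = inj₂ []
  linkedOrSplit P? (u ∷ [])    = inj₂ [-]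
  linkedOrSplit P? (u ∷ v ∷ c) with P? u v | linkedOrSplit P? (v ∷ c)
  ... | yes p  | _                              = inj₁ ([] , u , v , c , refl , p)
  ... | no _   | inj₁ (s , x , y , t , eq , p) = inj₁ (u ∷ s , x , y , t , cong (u ∷_) eq , p)
  ... | no ¬p  | inj₂ l                         = inj₂ (¬p ∷ l)

  rotate : ∀ {R : A → A → Set} {x xs} s {u v t} → x ∷ xs ≡ s ++ u ∷ v ∷ t →
    Linked R (x ∷ xs ++ [ x ]) → Linked R (v ∷ t ++ s ++ [ u ])
  rotate []       refl walk = Linked.tail walk
  rotate {R} (x ∷ s′) {u} {v} {t} refl walk =
    ++-join (v ∷ t) (++⁻ʳ (x ∷ s′ ++ [ u ]) walk′) (++⁻ˡ (x ∷ s′ ++ [ u ]) walk′)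
    where
    walk′ : Linked R ((x ∷ s′ ++ [ u ]) ++ v ∷ t ++ [ x ])
    walk′ = subst (Linked _)
      (cong (x ∷_) (trans (++-assoc s′ (u ∷ v ∷ t) [ x ]) (≡-sym (++-assoc s′ [ u ] (v ∷ t ++ [ x ])))))
      walk

  rotate-↭ : ∀ s (u v : A) t → v ∷ t ++ s ++ [ u ] ↭ s ++ u ∷ v ∷ t
  rotate-↭ s u v t = ↭-trans (++-comm (v ∷ t) (s ++ [ u ])) (↭-reflexive (++-assoc s [ u ] (v ∷ t)))

  Unique-resp-↭ : ∀ {xs ys : List A} → xs ↭ ys → Unique xs → Unique ys
  Unique-resp-↭ p = PermutationSetoid.Unique-resp-↭ (setoid A) (↭⇒↭ₛ p)

  _≐_ : A × A → A × A → Set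
  p ≐ (a , b) = p ≡ (a , b) ⊎ p ≡ (b , a)

  ≐-swap : ∀ {p} {a b : A} → p ≐ (a , b) → p ≐ (b , a)
  ≐-swap (inj₁ e) = inj₂ e
  ≐-swap (inj₂ e) = inj₁ e

  _∖_ : (A → A → Set) → A × A → A → A → Set
  (R ∖ e) x y = R x y × ¬ (x , y) ≐ e

  data Paired (R : A → A → Set) : List A → Set where
    []  : Paired R []
    _∷_ : ∀ {a b r} → R a b → Paired R r → Paired R (a ∷ b ∷ r)

  Paired-map : ∀ {R S : A → A → Set} → (∀ {u v} → R u v → S u v) → ∀ {q} → Paired R q → Paired S q
  Paired-map f []      = []
  Paired-map f (r ∷ p) = f r ∷ Paired-map f p

  linked⇒paired : ∀ {R : A → A → Set} {q} → Linked R q → 2 ∣ length q → Paired R q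
  linked⇒paired []       _                   = []
  linked⇒paired [-]      (divides zero ())
  linked⇒paired [-]      (divides (suc _) ())
  linked⇒paired (r ∷ l)  (divides (suc k) eq) =
    r ∷ linked⇒paired (Linked.tail l) (divides k (cong (ℕ.pred ∘ ℕ.pred) eq))

  Paired-avoiding : ∀ {R : A → A → Set} {u v r} → All (v ≢_) r → Paired R r →
    Paired (R ∖ (u , v)) r
  Paired-avoiding []                      []      = []
  Paired-avoiding (v≢x ∷ v≢y ∷ v∉r) (rxy ∷ p) = (rxy , avoid) ∷ Paired-avoiding v∉r p
    where
    avoid : ¬ _ ≐ _
    avoid (inj₁ refl) = v≢y refl
    avoid (inj₂ refl) = v≢x refl

  -- v is paired with y ≠ u, and all other pairs lie in r, which avoids v.
  Paired-ends : ∀ {R : A → A → Set} {u v y r} → Unique (v ∷ y ∷ r) → u ∈ r →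
    Paired R (v ∷ y ∷ r) → Paired (R ∖ (u , v)) (v ∷ y ∷ r)
  Paired-ends ((v≢y ∷ v∉r) ∷ (y∉r ∷ _)) u∈r (rvy ∷ p) = (rvy , avoid) ∷ Paired-avoiding v∉r p
    where
    avoid : ¬ _ ≐ _
    avoid (inj₁ refl) = v≢y refl
    avoid (inj₂ refl) = All.lookup y∉r u∈r refl

  Paired-rotation : ∀ {R : A → A → Set} s u v t → 3 ≤ length (s ++ u ∷ v ∷ t) →
    let q = v ∷ t ++ s ++ [ u ] in Unique q → Paired R q → Paired (R ∖ (u , v)) q
  Paired-rotation s       u v (y ∷ t) _ uq = Paired-ends uq (∈-++⁺ʳ t (∈-++⁺ʳ s (here refl)))
  Paired-rotation (y ∷ s) u v []      _ uq = Paired-ends uq (∈-++⁺ʳ s (here refl))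
  Paired-rotation []      u v []      (s≤s (s≤s ()))

module _ {n : ℕ} where

  _≟₂_ : (p q : Fin n × Fin n) → Dec (p ≡ q)
  _≟₂_ = ≡-dec _≟_ _≟_

  Enumeration : List (Fin n) → Set
  Enumeration q = Unique q × (∀ w → w ∈ q)

  length-enumeration : ∀ {q} → Enumeration q → length q ≡ n
  length-enumeration {q} (uq , cov) = trans
    (↭-length (∼bag⇒↭ (unique∧set⇒bag uq (Unique.allFin⁺ n) (mk⇔ (λ _ → ∈-allFin _) (λ _ → cov _)))))
    (length-tabulate (λ i → i))

  even-enumeration : 2 ∣ n → ∀ {q} → Enumeration q → 2 ∣ length q
  even-enumeration 2∣n enum = subst (2 ∣_) (≡-sym (length-enumeration enum)) 2∣n

  Enumeration-resp-↭ : ∀ {q q′} → q ↭ q′ → Enumeration q′ → Enumeration q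
  Enumeration-resp-↭ p (uq , cov) = Unique-resp-↭ (↭-sym p) uq , λ w → ∈-resp-↭ (↭-sym p) (cov w)

  mate : List (Fin n) → Fin n → Fin n
  mate []          v = v
  mate (a ∷ [])    v = v
  mate (a ∷ b ∷ r) v with v ≟ a | v ≟ b
  ... | yes _ | _     = b
  ... | no _  | yes _ = a
  ... | no _  | no _  = mate r v

  mate-fst : ∀ a b r → mate (a ∷ b ∷ r) a ≡ b
  mate-fst a b r with a ≟ a
  ... | yes _  = refl
  ... | no a≢a = ⊥-elim (a≢a refl)

  mate-snd : ∀ {a b} r → a ≢ b → mate (a ∷ b ∷ r) b ≡ a
  mate-snd {a} {b} r a≢b with b ≟ a | b ≟ b
  ... | yes b≡a | _      = ⊥-elim (a≢b (≡-sym b≡a))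
  ... | no _    | yes _  = refl
  ... | no _    | no b≢b = ⊥-elim (b≢b refl)

  mate-rest : ∀ {a b} r {v} → a ≢ v → b ≢ v → mate (a ∷ b ∷ r) v ≡ mate r v
  mate-rest {a} {b} r {v} a≢v b≢v with v ≟ a | v ≟ b
  ... | yes v≡a | _       = ⊥-elim (a≢v (≡-sym v≡a))
  ... | no _    | yes v≡b = ⊥-elim (b≢v (≡-sym v≡b))
  ... | no _    | no _    = refl

  mate-spec : ∀ {R : Fin n → Fin n → Set} → (∀ {u v} → R u v → R v u) →
    ∀ {q} → Paired R q → Unique q → ∀ {v} → v ∈ q →
    mate q v ∈ q × mate q (mate q v) ≡ v × R v (mate q v)
  mate-spec R-sym {a ∷ b ∷ r} (rab ∷ _) ((a≢b ∷ _) ∷ _) (here refl)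
    rewrite mate-fst a b r | mate-snd r a≢b = there (here refl) , refl , rab
  mate-spec R-sym {a ∷ b ∷ r} (rab ∷ _) ((a≢b ∷ _) ∷ _) (there (here refl))
    rewrite mate-snd r a≢b | mate-fst a b r = here refl , refl , R-sym rab
  mate-spec R-sym {a ∷ b ∷ r} (_ ∷ p) ((_ ∷ a∉r) ∷ (b∉r ∷ uq)) {v} (there (there v∈r))
    with mate-spec R-sym p uq v∈r
  ... | m∈r , involutive , rvm
    rewrite mate-rest r (All.lookup a∉r v∈r) (All.lookup b∉r v∈r)
          | mate-rest r (All.lookup a∉r m∈r) (All.lookup b∉r m∈r)
    = there (there m∈r) , involutive , rvm

  paired⇒HasFPM : ∀ {R : Fin n → Fin n → Set} → (∀ {u v} → R u v → R v u) →
    ∀ {q} → Enumeration q → Paired R q → HasFPM R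
  paired⇒HasFPM {R} R-sym {q} (uq , cov) p = g , g-sym , g-bounds , g-off-R , g-sum
    where
    spec : ∀ v → mate q v ∈ q × mate q (mate q v) ≡ v × R v (mate q v)
    spec v = mate-spec R-sym p uq (cov v)
    g : Fin n → Fin n → ℚ
    g u = indicator (mate q u)
    g-sym : ∀ u v → g u v ≡ g v u
    g-sym u v with mate q u ≟ v | mate q v ≟ u
    ... | yes _ | yes _ = refl
    ... | no _  | no _  = refl
    ... | yes refl | no m≢u = ⊥-elim (m≢u (proj₁ (proj₂ (spec u))))
    ... | no m≢v | yes refl = ⊥-elim (m≢v (proj₁ (proj₂ (spec v))))
    g-bounds : ∀ u v → 0ℚ ℚ.≤ g u v × g u v ℚ.≤ 1ℚ
    g-bounds u = indicator-bounds (mate q u)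
    g-off-R : ∀ u v → ¬ R u v → g u v ≡ 0ℚ
    g-off-R u v ¬ruv with mate q u ≟ v
    ... | yes refl = ⊥-elim (¬ruv (proj₂ (proj₂ (spec u))))
    ... | no _     = refl
    g-sum : ∀ v → sumℚ (g v) ≡ 1ℚ
    g-sum v = sumℚ-indicator (mate q v)

  hamiltonianPath⇒HasFPM : ∀ {R : Fin n → Fin n → Set} → (∀ {u v} → R u v → R v u) → 2 ∣ n →
    ∀ {q} → Enumeration q → Linked R q → HasFPM R
  hamiltonianPath⇒HasFPM R-sym 2∣n enum path =
    paired⇒HasFPM R-sym enum (linked⇒paired path (even-enumeration 2∣n enum))

  hamiltonianCycle⇒Paired-avoiding : ∀ {E : Fin n → Fin n → Set} → 2 ∣ n → ∀ {x xs} →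
    Enumeration (x ∷ xs) → 3 ≤ length (x ∷ xs) → Linked E (x ∷ xs ++ [ x ]) → ∀ a b →
    Σ (List (Fin n)) λ q → Enumeration q × Paired (E ∖ (a , b)) q
  hamiltonianCycle⇒Paired-avoiding {E} 2∣n {x} {xs} enum len walk a b
    with linkedOrSplit (λ u v → (u , v) ≟₂ (a , b) ⊎-dec (u , v) ≟₂ (b , a)) (x ∷ xs)
  ... | inj₂ avoids =
    x ∷ xs , enum ,
    linked⇒paired (Linked.zip (++⁻ˡ (x ∷ xs) walk , avoids)) (even-enumeration 2∣n enum)
  ... | inj₁ (s , u , v , t , split , uv≐ab) =
    q , enum′ , Paired-map (λ { (e , ¬≐) → e , ¬≐ ∘ transport uv≐ab })
                  (Paired-rotation s u v t (subst (λ c → 3 ≤ length c) split len) (proj₁ enum′) pairs)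
    where
    q : List (Fin n)
    q = v ∷ t ++ s ++ [ u ]
    enum′ : Enumeration q
    enum′ = Enumeration-resp-↭ (subst (q ↭_) (≡-sym split) (rotate-↭ s u v t)) enum
    pairs : Paired E q
    pairs = linked⇒paired (rotate s split walk) (even-enumeration 2∣n enum′)
    transport : (u , v) ≐ (a , b) → ∀ {p} → p ≐ (a , b) → p ≐ (u , v)
    transport (inj₁ refl) = λ e → e
    transport (inj₂ refl) = ≐-swap

module _ {n : ℕ} (G : Graph n) where

  EdgeMinus-sym : ∀ F {u v} → EdgeMinus G F u v → EdgeMinus G F v u
  EdgeMinus-sym F {u} {v} (e , uv∉F , vu∉F) = subst T (Graph.sym G u v) e , vu∉F , uv∉F

  EdgeMinus-∷ : ∀ {a b F u v} → EdgeMinus G F u v → ¬ (u , v) ≐ (a , b) → EdgeMinus G ((a , b) ∷ F) u v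
  EdgeMinus-∷ (e , uv∉F , vu∉F) ¬≐ =
    e , (λ { (here p) → ¬≐ (inj₁ p) ; (there m) → uv∉F m })
      , (λ { (here p) → ¬≐ (inj₂ (cong swap p)) ; (there m) → vu∉F m })

  faultHamiltonian⇒HasFPM : ∀ {f} → FaultHamiltonian G f → 2 ∣ n →
    ∀ F → EdgeList G F → length F ≤ suc f → HasFPM (EdgeMinus G F)
  faultHamiltonian⇒HasFPM fh 2∣n [] _ _ with fh [] [] [] z≤n
  ... | x , xs , uq , _ , cov , _ , walk =
    hamiltonianPath⇒HasFPM (EdgeMinus-sym []) 2∣n (uq , λ w → cov w λ ()) (++⁻ˡ (x ∷ xs) walk)
  faultHamiltonian⇒HasFPM fh 2∣n ((a , b) ∷ F) (_ ∷ F-edges) |F|≤1+f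
    with fh [] F F-edges (s≤s⁻¹ |F|≤1+f)
  ... | x , xs , uq , _ , cov , len , walk
    with hamiltonianCycle⇒Paired-avoiding 2∣n (uq , λ w → cov w λ ()) len walk a b
  ... | q , enum , pairs =
    paired⇒HasFPM (EdgeMinus-sym ((a , b) ∷ F)) enum
      (Paired-map (λ { (e , ¬≐) → EdgeMinus-∷ e ¬≐ }) pairs)

  orient : Fin n → Fin n → Fin n × Fin n
  orient v i with toℕ i ℕ.<? toℕ v
  ... | yes _ = (i , v)
  ... | no _  = (v , i)

  orient-cases : ∀ v i →
    (orient v i ≡ (i , v) × toℕ i < toℕ v) ⊎ (orient v i ≡ (v , i) × ¬ toℕ i < toℕ v)
  orient-cases v i with toℕ i ℕ.<? toℕ v
  ... | yes i<v = inj₁ (refl , i<v)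
  ... | no i≮v  = inj₂ (refl , i≮v)

  orient-injective : ∀ v {i j} → orient v i ≡ orient v j → i ≡ j
  orient-injective v {i} {j} eq with orient-cases v i | orient-cases v j
  ... | inj₁ (ei , _) | inj₁ (ej , _) with refl ← trans (≡-sym ei) (trans eq ej) = refl
  ... | inj₁ (ei , _) | inj₂ (ej , _) with refl ← trans (≡-sym ei) (trans eq ej) = refl
  ... | inj₂ (ei , _) | inj₁ (ej , _) with refl ← trans (≡-sym ei) (trans eq ej) = refl
  ... | inj₂ (ei , _) | inj₂ (ej , _) with refl ← trans (≡-sym ei) (trans eq ej) = refl

  neighbours : Fin n → List (Fin n)
  neighbours v = filterᵇ (adj G v) (allFin n)

  star : Fin n → List (Fin n × Fin n)
  star v = map (orient v) (neighbours v)

  length-filterᵇ-tabulate : ∀ {m} (p : Fin n → Bool) (f : Fin m → Fin n) →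
    length (filterᵇ p (tabulate f)) ≡ count (p ∘ f)
  length-filterᵇ-tabulate {zero}  p f = refl
  length-filterᵇ-tabulate {suc m} p f with p (f zero)
  ... | true  = cong suc (length-filterᵇ-tabulate p (f ∘ suc))
  ... | false = length-filterᵇ-tabulate p (f ∘ suc)

  length-star : ∀ v → length (star v) ≡ degree G v
  length-star v =
    trans (length-map (orient v) (neighbours v)) (length-filterᵇ-tabulate (adj G v) (λ i → i))

  star-unique : ∀ v → Unique (star v)
  star-unique v =
    Unique.map⁺ (orient-injective v) (Unique.filter⁺ (T? ∘ adj G v) {allFin n} (Unique.allFin⁺ n))

  star-edgeList : ∀ v → EdgeList G (star v)
  star-edgeList v =
    All.map⁺ (All.tabulate λ i∈N → oriented (proj₂ (∈-filter⁻ (T? ∘ adj G v) {xs = allFin n} i∈N)))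
    where
    OrderedEdge : Fin n × Fin n → Set
    OrderedEdge (u , w) = toℕ u < toℕ w × Edge G u w
    oriented : ∀ {i} → Edge G v i → OrderedEdge (orient v i)
    oriented {i} vi with orient-cases v i
    ... | inj₁ (e , i<v) = subst OrderedEdge (≡-sym e) (i<v , subst T (Graph.sym G v i) vi)
    ... | inj₂ (e , i≮v) = subst OrderedEdge (≡-sym e)
      (≤∧≢⇒< (≮⇒≥ i≮v) (λ v≡i → no-loop (toℕ-injective v≡i) vi) , vi)
      where
      no-loop : ∀ {i} → v ≡ i → ¬ Edge G v i
      no-loop refl vv = subst T (Graph.irrefl G v) vv

  orient-∈-star : ∀ {v u} → Edge G v u → orient v u ∈ star v
  orient-∈-star {v} {u} vu = ∈-map⁺ (orient v) (∈-filter⁺ (T? ∘ adj G v) (∈-allFin u) vu)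

  star-isolates : ∀ v u → ¬ EdgeMinus G (star v) v u
  star-isolates v u (vu , vu∉ , uv∉) with orient-cases v u
  ... | inj₁ (e , _) = uv∉ (subst (_∈ star v) e (orient-∈-star vu))
  ... | inj₂ (e , _) = vu∉ (subst (_∈ star v) e (orient-∈-star vu))

m<n⇒m≤1+n∸2 : ∀ {m δ} → m < δ → m ≤ suc (δ ∸ 2)
m<n⇒m≤1+n∸2 {δ = suc δ′} (s≤s m≤δ′) = ≤-trans m≤δ′ (m≤n+m∸n δ′ 1)

lemma3p2 : ∀ {n} (G : Graph n) (δ : ℕ) →
    MinDegree G δ → 3 ≤ δ →
    FaultHamiltonian G (δ ∸ 2) →
    2 ∣ n →
    FmpEq G δ
lemma3p2 G δ (_ , v , degree≡δ) _ fh 2∣n =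
  (star G v , star-edgeList G v , star-unique G v , trans (length-star G v) degree≡δ ,
   isolated⇒¬HasFPM (star-isolates G v)) ,
  λ F F-edges |F|<δ → faultHamiltonian⇒HasFPM G fh 2∣n F F-edges (m<n⇒m≤1+n∸2 |F|<δ)
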